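{- Let $a,b,c,d\in\mathbb{C}$ with $a+b+c+d\notin\{1,0,-1,-2,\ldots\}$ and $a+b,a+c,a+d\notin\{0,-1,-2,\ldots\}$, and let $x\in\mathbb{C}$. Then for every $n\ge0$, with $s=a+b+c+d$, $$\sum_{k=0}^n\frac{(s-1)_k\left(\frac{s+1}2\right)_k(-n)_k}{k!\left(\frac{s-1}2\right)_k(s+n)_k(a+b)_k(a+c)_k(a+d)_k}W_k(x^2;a,b,c,d)=\frac{(s)_n(a+ix)_n(a-ix)_n}{(a+b)_n(a+c)_n(a+d)_n}.$$
   Context: Rising factorial: $(\gamma)_0=1$, $(\gamma)_k=\gamma(\gamma+1)\cdots(\gamma+k-1)$. The Wilson polynomials are $W_n(x^2;a,b,c,d)=(a+b)_n(a+c)_n(a+d)_n\sum_{j=0}^n\frac{(-n)_j(n+a+b+c+d-1)_j(a+ix)_j(a-ix)_j}{j!\,(a+b)_j(a+c)_j(a+d)_j}$ (a terminating ${}_4F_3(1)$ series). -}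

module Defs where

open import Level using (Level; _⊔_)
open import Data.Nat as ℕ using (ℕ; zero; suc)
open import Data.Nat.Base using () renaming (_! to _!ℕ)
open import Data.Vec using (Vec; []; _∷_)
open import Data.Product using (∃)
open import Relation.Nullary using (¬_)
open import Algebra.Bundles using (CommutativeRing)

module RingOps {c ℓ : Level} (R : CommutativeRing c ℓ) where
  open CommutativeRing R using (Carrier; _+_; _*_; 0#; 1#)

  ofℕ : ℕ → Carrier
  ofℕ zero    = 0#
  ofℕ (suc n) = 1# + ofℕ n

  -- evaluation of the monic polynomial X^(n+1) + c_n X^n + ... + c_0
  -- with coefficient vector (c_n , ... , c_0)  (Horner scheme)
  hornerMonic : ∀ {n} → Vec Carrier n → Carrier → Carrier
  hornerMonic {n} cs z = go cs 1#
    where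
      go : ∀ {m} → Vec Carrier m → Carrier → Carrier
      go []       acc = acc * z
      go (c ∷ cs) acc = go cs (acc * z + c)

-- Since agda-stdlib has no complex numbers (no reals), the field ℂ is
-- represented abstractly: an algebraically closed field of characteristic 0,
-- given as a commutative ring together with a (total) inverse function
-- whose law is only required on nonzero elements.
record ACF₀ (c ℓ : Level) : Set (Level.suc (c ⊔ ℓ)) where
  field
    commRing : CommutativeRing c ℓ
  open CommutativeRing commRing public
  open RingOps commRing public
  field
    _⁻¹     : Carrier → Carrier
    inverse : ∀ x → ¬ (x ≈ 0#) → x * (x ⁻¹) ≈ 1#
    nontrivial : ¬ (1# ≈ 0#)
    charZero : ∀ n → ¬ (ofℕ (suc n) ≈ 0#)
    algClosed : ∀ n (cs : Vec Carrier n) → ∃ λ z → hornerMonic cs z ≈ 0#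

module FieldOps {c ℓ : Level} (K : ACF₀ c ℓ) where
  open ACF₀ K using (Carrier; _+_; _*_; -_; _-_; 0#; 1#; ofℕ; _⁻¹)

  infixl 7 _/_
  _/_ : Carrier → Carrier → Carrier
  x / y = x * (y ⁻¹)

  poch : Carrier → ℕ → Carrier
  poch γ zero    = 1#
  poch γ (suc k) = poch γ k * (γ + ofℕ k)

  fact : ℕ → Carrier
  fact k = ofℕ (k !ℕ)

  sumTo : ℕ → (ℕ → Carrier) → Carrier
  sumTo zero    f = f zero
  sumTo (suc n) f = sumTo n f + f (suc n)

  -- Wilson polynomial W_n(x²; a, b, c, d), with i a square root of -1
  wilson : (i a b c d x : Carrier) → ℕ → Carrier
  wilson i a b c d x n =
    poch (a + b) n * poch (a + c) n * poch (a + d) n *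
    sumTo n (λ j →
      (poch (- ofℕ n) j * poch (ofℕ n + (a + b + c + d) - 1#) j
        * poch (a + i * x) j * poch (a - i * x) j)
      / (fact j * poch (a + b) j * poch (a + c) j * poch (a + d) j))

-- Expand each W_k as its terminating ₄F₃ and interchange the two sums. The
-- coefficient of (a+ix)_j (a-ix)_j / (j! (a+b)_j (a+c)_j (a+d)_j) becomes the sum
-- Σ_k coeff_k (-k)_j (k+s-1)_j, where coeff_k (the theorem's coefficient times
-- (a+b)_k (a+c)_k (a+d)_k) depends only on s and n; its terms with k < j vanish
-- because (-k)_j = 0. For j < n the sum is 0, since its
-- summand is Gosper-summable in k with an antidifference vanishing at k = 0 and at
-- k = n + 1; for j = n only k = n survives and gives n! (s)_n. The hypotheses on s,
-- a+b, a+c and a+d are exactly what keeps every Pochhammer denominator nonzero.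
module Submission where

open import Defs
open import Level using (Level)
open import Data.Nat using (ℕ)
open import Relation.Nullary using (¬_)
open import Algebra.Bundles using (CommutativeRing)
open import Algebra.Solver.Ring.AlmostCommutativeRing
  using (fromCommutativeRing; _-Raw-AlmostCommutative⟶_)
import Algebra.Solver.Ring as RingSolver
import Algebra.Properties.Ring as RingProperties
open import Data.Nat as ℕ using (zero; suc; z≤n; s≤s)
open import Data.Nat.Base using () renaming (_! to _!ℕ)
import Data.Nat.Properties as ℕ
open import Data.Integer as ℤ using (ℤ; +_; -[1+_])
import Data.Integer.Properties as ℤ
open import Data.Maybe using (Maybe; just; nothing)
open import Data.Product using (_,_)
open import Data.Sum using (inj₁; inj₂)
open import Relation.Nullary using (yes; no)
import Relation.Binary.PropositionalEquality as ≡
import Relation.Binary.Reasoning.Setoid as SetoidReasoning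

module IntegerCoefficients {c ℓ : Level} (R : CommutativeRing c ℓ) where
  open CommutativeRing R
  open RingOps R
  open RingProperties ring using (-0#≈0#; -‿involutive; -‿+-comm; -‿distribˡ-*; -‿distribʳ-*)
  open SetoidReasoning setoid

  ofℕ-+ : ∀ m n → ofℕ (m ℕ.+ n) ≈ ofℕ m + ofℕ n
  ofℕ-+ zero    n = sym (+-identityˡ _)
  ofℕ-+ (suc m) n = trans (+-congˡ (ofℕ-+ m n)) (sym (+-assoc _ _ _))

  ofℕ-* : ∀ m n → ofℕ (m ℕ.* n) ≈ ofℕ m * ofℕ n
  ofℕ-* zero    n = sym (zeroˡ _)
  ofℕ-* (suc m) n = begin
    ofℕ (n ℕ.+ m ℕ.* n)            ≈⟨ ofℕ-+ n (m ℕ.* n) ⟩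
    ofℕ n + ofℕ (m ℕ.* n)          ≈⟨ +-cong (sym (*-identityˡ _)) (ofℕ-* m n) ⟩
    1# * ofℕ n + ofℕ m * ofℕ n     ≈⟨ distribʳ _ _ _ ⟨
    (1# + ofℕ m) * ofℕ n           ∎

  fromℤ : ℤ → Carrier
  fromℤ (+ n)      = ofℕ n
  fromℤ -[1+ n ]   = - ofℕ (suc n)

  fromℤ-neg : ∀ z → fromℤ (ℤ.- z) ≈ - fromℤ z
  fromℤ-neg (+ zero)  = sym -0#≈0#
  fromℤ-neg (+ suc n) = refl
  fromℤ-neg -[1+ n ]  = sym (-‿involutive _)

  fromℤ-⊖ : ∀ m n → fromℤ (m ℤ.⊖ n) ≈ ofℕ m - ofℕ n
  fromℤ-⊖ zero    zero    = sym (-‿inverseʳ _)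
  fromℤ-⊖ (suc m) zero    = sym (trans (+-congˡ -0#≈0#) (+-identityʳ _))
  fromℤ-⊖ zero    (suc n) = sym (+-identityˡ _)
  fromℤ-⊖ (suc m) (suc n) = begin
    fromℤ (suc m ℤ.⊖ suc n)              ≡⟨ ≡.cong fromℤ (ℤ.[1+m]⊖[1+n]≡m⊖n m n) ⟩
    fromℤ (m ℤ.⊖ n)                      ≈⟨ fromℤ-⊖ m n ⟩
    ofℕ m - ofℕ n                        ≈⟨ +-congʳ (+-identityˡ _) ⟨
    (0# + ofℕ m) - ofℕ n                 ≈⟨ +-congʳ (+-congʳ (-‿inverseʳ 1#)) ⟨
    ((1# - 1#) + ofℕ m) - ofℕ n          ≈⟨ +-congʳ (trans (+-assoc _ _ _) (+-congˡ (+-comm _ _))) ⟩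
    (1# + (ofℕ m - 1#)) - ofℕ n          ≈⟨ +-congʳ (+-assoc _ _ _) ⟨
    ((1# + ofℕ m) - 1#) - ofℕ n          ≈⟨ +-assoc _ _ _ ⟩
    (1# + ofℕ m) + (- 1# - ofℕ n)        ≈⟨ +-congˡ (-‿+-comm _ _) ⟩
    (1# + ofℕ m) - (1# + ofℕ n)          ∎

  fromℤ-+ : ∀ x y → fromℤ (x ℤ.+ y) ≈ fromℤ x + fromℤ y
  fromℤ-+ (+ m)    (+ n)    = ofℕ-+ m n
  fromℤ-+ (+ m)    -[1+ n ] = fromℤ-⊖ m (suc n)
  fromℤ-+ -[1+ m ] (+ n)    = trans (fromℤ-⊖ n (suc m)) (+-comm _ _)
  fromℤ-+ -[1+ m ] -[1+ n ] = begin
    - ofℕ (suc (suc (m ℕ.+ n)))        ≡⟨ ≡.cong (λ k → - ofℕ (suc k)) (≡.sym (ℕ.+-suc m n)) ⟩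
    - ofℕ (suc m ℕ.+ suc n)            ≈⟨ -‿cong (ofℕ-+ (suc m) (suc n)) ⟩
    - (ofℕ (suc m) + ofℕ (suc n))      ≈⟨ -‿+-comm _ _ ⟨
    - ofℕ (suc m) - ofℕ (suc n)        ∎

  fromℤ-* : ∀ x y → fromℤ (x ℤ.* y) ≈ fromℤ x * fromℤ y
  fromℤ-* (+ m) (+ n) = trans (reflexive (≡.cong fromℤ (≡.sym (ℤ.pos-* m n)))) (ofℕ-* m n)
  fromℤ-* (+ m) -[1+ n ] = begin
    fromℤ (+ m ℤ.* ℤ.- + suc n)        ≡⟨ ≡.cong fromℤ (≡.sym (ℤ.neg-distribʳ-* (+ m) (+ suc n))) ⟩
    fromℤ (ℤ.- (+ m ℤ.* + suc n))      ≈⟨ fromℤ-neg (+ m ℤ.* + suc n) ⟩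
    - fromℤ (+ m ℤ.* + suc n)          ≈⟨ -‿cong (fromℤ-* (+ m) (+ suc n)) ⟩
    - (ofℕ m * ofℕ (suc n))            ≈⟨ -‿distribʳ-* _ _ ⟩
    ofℕ m * - ofℕ (suc n)              ∎
  fromℤ-* -[1+ m ] (+ n) = begin
    fromℤ (ℤ.- + suc m ℤ.* + n)        ≡⟨ ≡.cong fromℤ (≡.sym (ℤ.neg-distribˡ-* (+ suc m) (+ n))) ⟩
    fromℤ (ℤ.- (+ suc m ℤ.* + n))      ≈⟨ fromℤ-neg (+ suc m ℤ.* + n) ⟩
    - fromℤ (+ suc m ℤ.* + n)          ≈⟨ -‿cong (fromℤ-* (+ suc m) (+ n)) ⟩
    - (ofℕ (suc m) * ofℕ n)            ≈⟨ -‿distribˡ-* _ _ ⟩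
    - ofℕ (suc m) * ofℕ n              ∎
  fromℤ-* -[1+ m ] -[1+ n ] = begin
    ofℕ (suc m ℕ.* suc n)              ≈⟨ ofℕ-* (suc m) (suc n) ⟩
    ofℕ (suc m) * ofℕ (suc n)          ≈⟨ -‿involutive _ ⟨
    - - (ofℕ (suc m) * ofℕ (suc n))    ≈⟨ -‿cong (-‿distribˡ-* _ _) ⟩
    - (- ofℕ (suc m) * ofℕ (suc n))    ≈⟨ -‿distribʳ-* _ _ ⟩
    - ofℕ (suc m) * - ofℕ (suc n)      ∎

  -- A copy of fromℤ with fromℤ′ (+ 1) = 1# definitionally, so that the solver
  -- constants con (+ 0) and con (+ 1) denote 0# and 1# on the nose.
  ofℕ′ : ℕ → Carrier
  ofℕ′ zero          = 0#
  ofℕ′ (suc zero)    = 1#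
  ofℕ′ (suc (suc n)) = 1# + ofℕ′ (suc n)

  ofℕ′≈ofℕ : ∀ n → ofℕ′ n ≈ ofℕ n
  ofℕ′≈ofℕ zero          = refl
  ofℕ′≈ofℕ (suc zero)    = sym (+-identityʳ 1#)
  ofℕ′≈ofℕ (suc (suc n)) = +-congˡ (ofℕ′≈ofℕ (suc n))

  fromℤ′ : ℤ → Carrier
  fromℤ′ (+ n)    = ofℕ′ n
  fromℤ′ -[1+ n ] = - ofℕ′ (suc n)

  fromℤ′≈fromℤ : ∀ z → fromℤ′ z ≈ fromℤ z
  fromℤ′≈fromℤ (+ n)    = ofℕ′≈ofℕ n
  fromℤ′≈fromℤ -[1+ n ] = -‿cong (ofℕ′≈ofℕ (suc n))

  fromℤ′-homomorphism : ℤ.+-*-rawRing -Raw-AlmostCommutative⟶ fromCommutativeRing R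
  fromℤ′-homomorphism = record
    { ⟦_⟧    = fromℤ′
    ; +-homo = λ x y → transport (x ℤ.+ y) (+-cong (fromℤ′≈fromℤ x) (fromℤ′≈fromℤ y)) (fromℤ-+ x y)
    ; *-homo = λ x y → transport (x ℤ.* y) (*-cong (fromℤ′≈fromℤ x) (fromℤ′≈fromℤ y)) (fromℤ-* x y)
    ; -‿homo = λ x → transport (ℤ.- x) (-‿cong (fromℤ′≈fromℤ x)) (fromℤ-neg x)
    ; 0-homo = refl
    ; 1-homo = refl
    }
    where
    transport : ∀ z {u u′} → u′ ≈ u → fromℤ z ≈ u → fromℤ′ z ≈ u′
    transport z u′≈u e = trans (fromℤ′≈fromℤ z) (trans e (sym u′≈u))

  ≟-coefficients : ∀ x y → Maybe (fromℤ′ x ≈ fromℤ′ y)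
  ≟-coefficients x y with x ℤ.≟ y
  ... | yes ≡.refl = just refl
  ... | no _       = nothing

  open RingSolver ℤ.+-*-rawRing (fromCommutativeRing R) fromℤ′-homomorphism ≟-coefficients public
    using (Polynomial; solve; _:=_; _:+_; _:*_; :-_; _:-_; con)

  :1 :2 : ∀ {m} → Polynomial m
  :1 = con (+ 1)
  :2 = :1 :+ (:1 :+ con (+ 0))

module FieldLemmas {c ℓ : Level} (K : ACF₀ c ℓ) where
  open ACF₀ K
  open FieldOps K
  open IntegerCoefficients commRing using (solve; _:=_; _:*_)
  open SetoidReasoning setoid

  x≈0⇒x*y≈0 : ∀ {x} → x ≈ 0# → ∀ y → x * y ≈ 0#
  x≈0⇒x*y≈0 x≈0 y = trans (*-congʳ x≈0) (zeroˡ y)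

  y≈0⇒x*y≈0 : ∀ {y} → y ≈ 0# → ∀ x → x * y ≈ 0#
  y≈0⇒x*y≈0 y≈0 x = trans (*-congˡ y≈0) (zeroʳ x)

  *-cancelʳ : ∀ {x y z} → z ≉ 0# → x * z ≈ y * z → x ≈ y
  *-cancelʳ {x} {y} {z} z≉0 xz≈yz = begin
    x                 ≈⟨ *-identityʳ x ⟨
    x * 1#            ≈⟨ *-congˡ (inverse z z≉0) ⟨
    x * (z * z ⁻¹)    ≈⟨ *-assoc x z (z ⁻¹) ⟨
    x * z * z ⁻¹      ≈⟨ *-congʳ xz≈yz ⟩
    y * z * z ⁻¹      ≈⟨ *-assoc y z (z ⁻¹) ⟩
    y * (z * z ⁻¹)    ≈⟨ *-congˡ (inverse z z≉0) ⟩
    y * 1#            ≈⟨ *-identityʳ y ⟩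
    y                 ∎

  *-≉0 : ∀ {x y} → x ≉ 0# → y ≉ 0# → x * y ≉ 0#
  *-≉0 {x} {y} x≉0 y≉0 xy≈0 = x≉0 (*-cancelʳ y≉0 (trans xy≈0 (sym (zeroˡ y))))

  ⁻¹-inverseˡ : ∀ {y} → y ≉ 0# → y ⁻¹ * y ≈ 1#
  ⁻¹-inverseˡ {y} y≉0 = trans (*-comm _ _) (inverse y y≉0)

  /-*-cancelʳ : ∀ {y} → y ≉ 0# → ∀ x → x / y * y ≈ x
  /-*-cancelʳ {y} y≉0 x = begin
    x * y ⁻¹ * y      ≈⟨ *-assoc x (y ⁻¹) y ⟩
    x * (y ⁻¹ * y)    ≈⟨ *-congˡ (⁻¹-inverseˡ y≉0) ⟩
    x * 1#            ≈⟨ *-identityʳ x ⟩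
    x                 ∎

  x≈z*y⇒x/y≈z : ∀ {x y z} → y ≉ 0# → x ≈ z * y → x / y ≈ z
  x≈z*y⇒x/y≈z {x} y≉0 x≈zy = *-cancelʳ y≉0 (trans (/-*-cancelʳ y≉0 x) x≈zy)

  x*w≈z*y⇒x/y≈z/w : ∀ {x y z w} → y ≉ 0# → w ≉ 0# → x * w ≈ z * y → x / y ≈ z / w
  x*w≈z*y⇒x/y≈z/w {x} {y} {z} {w} y≉0 w≉0 xw≈zy = x≈z*y⇒x/y≈z y≉0 (*-cancelʳ w≉0 (begin
    x * w             ≈⟨ xw≈zy ⟩
    z * y             ≈⟨ *-congʳ (/-*-cancelʳ w≉0 z) ⟨
    z / w * w * y     ≈⟨ solve 3 (λ a b c → a :* b :* c := a :* c :* b) refl (z / w) w y ⟩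
    z / w * y * w     ∎))

  *-/-cancelʳ : ∀ {y} → y ≉ 0# → ∀ x → x * y / y ≈ x
  *-/-cancelʳ y≉0 x = x≈z*y⇒x/y≈z y≉0 refl

  x*v/y*w≈x : ∀ {x v w y} → y ≉ 0# → y ≈ w * v → x * v / y * w ≈ x
  x*v/y*w≈x {x} {v} {w} {y} y≉0 y≈wv = begin
    x * v * y ⁻¹ * w      ≈⟨ solve 4 (λ a b c d → a :* b :* c :* d := a :* (d :* b) :* c) refl x v (y ⁻¹) w ⟩
    x * (w * v) / y       ≈⟨ *-congʳ (*-congˡ y≈wv) ⟨
    x * y / y             ≈⟨ *-/-cancelʳ y≉0 x ⟩
    x                     ∎

module SumLemmas {c ℓ : Level} (K : ACF₀ c ℓ) where
  open ACF₀ K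
  open FieldOps K
  open IntegerCoefficients commRing using (solve; _:=_; _:+_; _:-_)
  open SetoidReasoning setoid

  sumTo-cong : ∀ n {f g : ℕ → Carrier} → (∀ k → k ℕ.≤ n → f k ≈ g k) → sumTo n f ≈ sumTo n g
  sumTo-cong zero    f≈g = f≈g 0 z≤n
  sumTo-cong (suc n) f≈g = +-cong (sumTo-cong n (λ k k≤n → f≈g k (ℕ.m≤n⇒m≤1+n k≤n))) (f≈g (suc n) ℕ.≤-refl)

  sumTo-+ : ∀ n (f g : ℕ → Carrier) → sumTo n f + sumTo n g ≈ sumTo n (λ k → f k + g k)
  sumTo-+ zero    f g = refl
  sumTo-+ (suc n) f g = trans
    (solve 4 (λ a b c d → a :+ b :+ (c :+ d) := a :+ c :+ (b :+ d)) refl (sumTo n f) (f (suc n)) (sumTo n g) (g (suc n)))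
    (+-congʳ (sumTo-+ n f g))

  sumTo-*ˡ : ∀ n (f : ℕ → Carrier) x → x * sumTo n f ≈ sumTo n (λ k → x * f k)
  sumTo-*ˡ zero    f x = refl
  sumTo-*ˡ (suc n) f x = trans (distribˡ _ _ _) (+-congʳ (sumTo-*ˡ n f x))

  sumTo-*ʳ : ∀ n (f : ℕ → Carrier) x → sumTo n f * x ≈ sumTo n (λ k → f k * x)
  sumTo-*ʳ zero    f x = refl
  sumTo-*ʳ (suc n) f x = trans (distribʳ _ _ _) (+-congʳ (sumTo-*ʳ n f x))

  sumTo-comm : ∀ m n (F : ℕ → ℕ → Carrier) →
               sumTo m (λ k → sumTo n (F k)) ≈ sumTo n (λ j → sumTo m (λ k → F k j))
  sumTo-comm zero    n F = refl
  sumTo-comm (suc m) n F = trans (+-congʳ (sumTo-comm m n F)) (sumTo-+ n _ _)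

  sumTo-≈0 : ∀ n (f : ℕ → Carrier) → (∀ k → k ℕ.≤ n → f k ≈ 0#) → sumTo n f ≈ 0#
  sumTo-≈0 n f f≈0 = trans (sumTo-cong n f≈0) (sumTo-0 n)
    where
    sumTo-0 : ∀ n → sumTo n (λ _ → 0#) ≈ 0#
    sumTo-0 zero    = refl
    sumTo-0 (suc n) = trans (+-identityʳ _) (sumTo-0 n)

  sumTo-last : ∀ n (f : ℕ → Carrier) → (∀ k → k ℕ.< n → f k ≈ 0#) → sumTo n f ≈ f n
  sumTo-last zero    f _    = refl
  sumTo-last (suc n) f f≈0 = trans (+-congʳ (sumTo-≈0 n f (λ k k≤n → f≈0 k (s≤s k≤n)))) (+-identityˡ _)

  sumTo-extend : ∀ {m} n (f : ℕ → Carrier) → m ℕ.≤ n → (∀ k → m ℕ.< k → f k ≈ 0#) → sumTo m f ≈ sumTo n f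
  sumTo-extend zero    f z≤n _ = refl
  sumTo-extend {m} (suc n) f m≤1+n f≈0 with ℕ.m≤n⇒m<n∨m≡n m≤1+n
  ... | inj₂ ≡.refl    = refl
  ... | inj₁ (s≤s m≤n) = begin
    sumTo m f              ≈⟨ sumTo-extend n f m≤n f≈0 ⟩
    sumTo n f              ≈⟨ +-identityʳ _ ⟨
    sumTo n f + 0#         ≈⟨ +-congˡ (f≈0 (suc n) (s≤s m≤n)) ⟨
    sumTo (suc n) f        ∎

  sumTo-telescope : ∀ n (g : ℕ → Carrier) → sumTo n (λ k → g (suc k) - g k) ≈ g (suc n) - g 0
  sumTo-telescope zero    g = refl
  sumTo-telescope (suc n) g = trans (+-congʳ (sumTo-telescope n g))
    (solve 3 (λ a b c → b :- c :+ (a :- b) := a :- c) refl (g (suc (suc n))) (g (suc n)) (g 0))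

module PochhammerLemmas {c ℓ : Level} (K : ACF₀ c ℓ) where
  open ACF₀ K
  open FieldOps K
  open IntegerCoefficients commRing
  open RingProperties ring using (-0#≈0#)
  open FieldLemmas K
  open SetoidReasoning setoid

  ≉-ofℕ⇒+ofℕ≉0 : ∀ {y} → (∀ m → y ≉ - ofℕ m) → ∀ m → y + ofℕ m ≉ 0#
  ≉-ofℕ⇒+ofℕ≉0 {y} y≉-m m y+m≈0 = y≉-m m (begin
    y                   ≈⟨ solve 2 (λ y m → y := y :+ m :- m) refl y (ofℕ m) ⟩
    y + ofℕ m - ofℕ m   ≈⟨ +-congʳ y+m≈0 ⟩
    0# - ofℕ m          ≈⟨ +-identityˡ _ ⟩
    - ofℕ m             ∎)

  <⇒ofℕ-ofℕ≉0 : ∀ {j n} → j ℕ.< n → ofℕ j - ofℕ n ≉ 0#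
  <⇒ofℕ-ofℕ≉0 {j} {n} j<n j-n≈0 with ℕ.m≤n⇒∃[o]m+o≡n j<n
  ... | d , 1+j+d≡n = charZero d (begin
    ofℕ (suc d)                          ≈⟨ solve 2 (λ J D → D := :- (J :- (J :+ D))) refl (ofℕ j) (ofℕ (suc d)) ⟩
    - (ofℕ j - (ofℕ j + ofℕ (suc d)))    ≈⟨ -‿cong (+-congˡ (-‿cong (ofℕ-+ j (suc d)))) ⟨
    - (ofℕ j - ofℕ (j ℕ.+ suc d))        ≡⟨ ≡.cong (λ k → - (ofℕ j - ofℕ k)) (≡.trans (ℕ.+-suc j d) 1+j+d≡n) ⟩
    - (ofℕ j - ofℕ n)                    ≈⟨ -‿cong j-n≈0 ⟩
    - 0#                                 ≈⟨ -0#≈0# ⟩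
    0#                                   ∎)

  fact-suc : ∀ k → fact (suc k) ≈ fact k * (1# + ofℕ k)
  fact-suc k = trans (ofℕ-* (suc k) (k !ℕ)) (*-comm _ _)

  fact≉0 : ∀ k → fact k ≉ 0#
  fact≉0 k with k !ℕ | ℕ.1≤n! k
  ... | suc m | _ = charZero m

  poch-cong : ∀ {γ δ} → γ ≈ δ → ∀ k → poch γ k ≈ poch δ k
  poch-cong γ≈δ zero    = refl
  poch-cong γ≈δ (suc k) = *-cong (poch-cong γ≈δ k) (+-congʳ γ≈δ)

  poch≉0 : ∀ {γ} → (∀ m → γ + ofℕ m ≉ 0#) → ∀ k → poch γ k ≉ 0#
  poch≉0 γ+m≉0 zero    = nontrivial
  poch≉0 γ+m≉0 (suc k) = *-≉0 (poch≉0 γ+m≉0 k) (γ+m≉0 k)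

  ≉-ofℕ⇒poch≉0 : ∀ {γ} → (∀ m → γ ≉ - ofℕ m) → ∀ k → poch γ k ≉ 0#
  ≉-ofℕ⇒poch≉0 γ≉-m = poch≉0 (≉-ofℕ⇒+ofℕ≉0 γ≉-m)

  poch-shift : ∀ γ k → poch (γ + 1#) k * γ ≈ poch γ k * (γ + ofℕ k)
  poch-shift γ zero    = solve 1 (λ g → :1 :* g := :1 :* (g :+ con (+ 0))) refl γ
  poch-shift γ (suc k) = begin
    poch (γ + 1#) k * (γ + 1# + ofℕ k) * γ    ≈⟨ solve 3 (λ p g m → p :* (g :+ :1 :+ m) :* g := p :* g :* (g :+ :1 :+ m)) refl (poch (γ + 1#) k) γ (ofℕ k) ⟩
    poch (γ + 1#) k * γ * (γ + 1# + ofℕ k)    ≈⟨ *-cong (poch-shift γ k) (+-assoc γ 1# (ofℕ k)) ⟩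
    poch γ k * (γ + ofℕ k) * (γ + ofℕ (suc k)) ∎

  poch-+ : ∀ γ m k → poch γ (m ℕ.+ k) ≈ poch γ m * poch (γ + ofℕ m) k
  poch-+ γ m zero    rewrite ℕ.+-identityʳ m = sym (*-identityʳ _)
  poch-+ γ m (suc k) rewrite ℕ.+-suc m k = begin
    poch γ (m ℕ.+ k) * (γ + ofℕ (m ℕ.+ k))                 ≈⟨ *-cong (poch-+ γ m k) (+-congˡ (ofℕ-+ m k)) ⟩
    poch γ m * poch (γ + ofℕ m) k * (γ + (ofℕ m + ofℕ k))
      ≈⟨ solve 5 (λ a b g x y → a :* b :* (g :+ (x :+ y)) := a :* (b :* (g :+ x :+ y))) refl (poch γ m) (poch (γ + ofℕ m) k) γ (ofℕ m) (ofℕ k) ⟩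
    poch γ m * (poch (γ + ofℕ m) k * (γ + ofℕ m + ofℕ k))  ∎

  poch-neg-vanish : ∀ {k j} → k ℕ.< j → poch (- ofℕ k) j ≈ 0#
  poch-neg-vanish {k} {suc j} (s≤s k≤j) with ℕ.m≤n⇒m<n∨m≡n k≤j
  ... | inj₂ ≡.refl = y≈0⇒x*y≈0 (-‿inverseˡ (ofℕ k)) _
  ... | inj₁ k<j    = x≈0⇒x*y≈0 (poch-neg-vanish k<j) _

  poch-neg-square : ∀ n → poch (- ofℕ n) n * poch (- ofℕ n) n ≈ fact n * fact n
  poch-neg-square zero    = solve 0 (:1 :* :1 := (:1 :+ con (+ 0)) :* (:1 :+ con (+ 0))) refl
  poch-neg-square (suc n) = begin
    poch (- m) (suc n) * poch (- m) (suc n)           ≈⟨ *-cong step step ⟩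
    poch (- ofℕ n) n * - m * (poch (- ofℕ n) n * - m) ≈⟨ solve 2 (λ b m → b :* :- m :* (b :* :- m) := b :* b :* (m :* m)) refl (poch (- ofℕ n) n) m ⟩
    poch (- ofℕ n) n * poch (- ofℕ n) n * (m * m)     ≈⟨ *-congʳ (poch-neg-square n) ⟩
    fact n * fact n * (m * m)                         ≈⟨ solve 2 (λ f m → f :* f :* (m :* m) := f :* m :* (f :* m)) refl (fact n) m ⟩
    fact n * m * (fact n * m)                         ≈⟨ *-cong (fact-suc n) (fact-suc n) ⟨
    fact (suc n) * fact (suc n)                       ∎
    where
    m = ofℕ (suc n)
    step : poch (- m) (suc n) ≈ poch (- ofℕ n) n * - m
    step = begin
      poch (- m) n * (- m + ofℕ n)   ≈⟨ poch-shift (- m) n ⟨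
      poch (- m + 1#) n * - m        ≈⟨ *-congʳ (poch-cong (solve 1 (λ k → :- (:1 :+ k) :+ :1 := :- k) refl (ofℕ n)) n) ⟩
      poch (- ofℕ n) n * - m         ∎

  poch-neg-suc : ∀ k j → poch (- ofℕ (suc k)) j * (ofℕ (suc k) - ofℕ j) ≈ poch (- ofℕ k) j * ofℕ (suc k)
  poch-neg-suc k j = begin
    poch γ j * (m - ofℕ j)      ≈⟨ solve 3 (λ b m J → b :* (m :- J) := :- (b :* (:- m :+ J))) refl (poch γ j) m (ofℕ j) ⟩
    - (poch γ j * (γ + ofℕ j))  ≈⟨ -‿cong (poch-shift γ j) ⟨
    - (poch (γ + 1#) j * γ)     ≈⟨ -‿cong (*-congʳ (poch-cong (solve 1 (λ k → :- (:1 :+ k) :+ :1 := :- k) refl (ofℕ k)) j)) ⟩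
    - (poch (- ofℕ k) j * γ)    ≈⟨ solve 2 (λ b m → :- (b :* :- m) := b :* m) refl (poch (- ofℕ k) j) m ⟩
    poch (- ofℕ k) j * m        ∎
    where
    m = ofℕ (suc k)
    γ = - m

module ConnectionCoefficients {c ℓ : Level} (K : ACF₀ c ℓ) (s : ACF₀.Carrier K) (n : ℕ) where
  open ACF₀ K
  open FieldOps K
  open IntegerCoefficients commRing
  open FieldLemmas K
  open SumLemmas K
  open PochhammerLemmas K
  open SetoidReasoning setoid

  h₀ h₁ : Carrier
  h₀ = (s - 1#) / ofℕ 2
  h₁ = (s + 1#) / ofℕ 2

  numerator denominator coeff : ℕ → Carrier
  numerator k   = poch (s - 1#) k * poch h₁ k * poch (- ofℕ n) k
  denominator k = fact k * poch h₀ k * poch (s + ofℕ n) k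
  coeff k       = numerator k / denominator k

  summand : ℕ → ℕ → Carrier
  summand j k = coeff k * (poch (- ofℕ k) j * poch (ofℕ k + s - 1#) j)

  summand-vanish : ∀ {j k} → k ℕ.< j → summand j k ≈ 0#
  summand-vanish k<j = y≈0⇒x*y≈0 (x≈0⇒x*y≈0 (poch-neg-vanish k<j) _) _

  h₀*2≈s-1 : h₀ * ofℕ 2 ≈ s - 1#
  h₀*2≈s-1 = trans (*-assoc _ _ _) (trans (*-congˡ (⁻¹-inverseˡ (charZero 1))) (*-identityʳ _))

  h₁≈h₀+1 : h₁ ≈ h₀ + 1#
  h₁≈h₀+1 = begin
    (s + 1#) * ofℕ 2 ⁻¹                        ≈⟨ solve 2 (λ s h → (s :+ :1) :* h := (s :- :1) :* h :+ h :* :2) refl s (ofℕ 2 ⁻¹) ⟩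
    (s - 1#) * ofℕ 2 ⁻¹ + ofℕ 2 ⁻¹ * ofℕ 2     ≈⟨ +-congˡ (⁻¹-inverseˡ (charZero 1)) ⟩
    h₀ + 1#                                    ∎

  poch-h₁ : ∀ k → poch h₁ k * (s - 1#) ≈ poch h₀ k * (s - 1# + (ofℕ k + ofℕ k))
  poch-h₁ k = begin
    poch h₁ k * (s - 1#)                           ≈⟨ *-cong (poch-cong h₁≈h₀+1 k) (sym h₀*2≈s-1) ⟩
    poch (h₀ + 1#) k * (h₀ * ofℕ 2)                ≈⟨ *-assoc _ _ _ ⟨
    poch (h₀ + 1#) k * h₀ * ofℕ 2                  ≈⟨ *-congʳ (poch-shift h₀ k) ⟩
    poch h₀ k * (h₀ + ofℕ k) * ofℕ 2               ≈⟨ solve 3 (λ P h k → P :* (h :+ k) :* :2 := P :* (h :* :2 :+ (k :+ k))) refl (poch h₀ k) h₀ (ofℕ k) ⟩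
    poch h₀ k * (h₀ * ofℕ 2 + (ofℕ k + ofℕ k))     ≈⟨ *-congˡ (+-congʳ h₀*2≈s-1) ⟩
    poch h₀ k * (s - 1# + (ofℕ k + ofℕ k))         ∎

  sharedFactor : ℕ → ℕ → Carrier
  sharedFactor j k = poch (s - 1#) k * poch (ofℕ k + s - 1#) j * poch (- ofℕ k) j * poch (- ofℕ n) k

  certificateDenominator : ℕ → Carrier
  certificateDenominator k = fact k * poch (s + ofℕ n) k

  -- The certificate is what Gosper's algorithm returns for summand j as a term in k.
  certificate : ℕ → ℕ → Carrier
  certificate j k = sharedFactor j k * ((ofℕ k - ofℕ j) * (s + ofℕ n + ofℕ k - 1#)) / certificateDenominator k

  certificate-start : ∀ j → certificate j 0 ≈ 0#
  certificate-start zero    = x≈0⇒x*y≈0 (y≈0⇒x*y≈0 (x≈0⇒x*y≈0 (-‿inverseʳ 0#) _) _) _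
  certificate-start (suc j) = x≈0⇒x*y≈0 (x≈0⇒x*y≈0 (x≈0⇒x*y≈0 (y≈0⇒x*y≈0 (poch-neg-vanish {0} {suc j} (s≤s z≤n)) _) _) _) _

  certificate-end : ∀ j → certificate j (suc n) ≈ 0#
  certificate-end j = x≈0⇒x*y≈0 (x≈0⇒x*y≈0 (y≈0⇒x*y≈0 (poch-neg-vanish {n} {suc n} ℕ.≤-refl) _) _) _

  certificateDenominator-suc : ∀ k → certificateDenominator (suc k) ≈ certificateDenominator k * ((1# + ofℕ k) * (s + ofℕ n + ofℕ k))
  certificateDenominator-suc k = begin
    fact (suc k) * (S * (s + ofℕ n + ofℕ k))            ≈⟨ *-congʳ (fact-suc k) ⟩
    fact k * (1# + ofℕ k) * (S * (s + ofℕ n + ofℕ k))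
      ≈⟨ solve 4 (λ f k S x → f :* k :* (S :* x) := f :* S :* (k :* x)) refl (fact k) (1# + ofℕ k) S (s + ofℕ n + ofℕ k) ⟩
    fact k * S * ((1# + ofℕ k) * (s + ofℕ n + ofℕ k))   ∎
    where S = poch (s + ofℕ n) k

  sharedFactor-suc : ∀ j k → sharedFactor j (suc k) * ((ofℕ (suc k) - ofℕ j) * (s + ofℕ n + ofℕ (suc k) - 1#))
                             ≈ sharedFactor j k * ((s - 1# + ofℕ k + ofℕ j) * (ofℕ k - ofℕ n)) * ((1# + ofℕ k) * (s + ofℕ n + ofℕ k))
  sharedFactor-suc j k = begin
    P * (s - 1# + k′) * α′ * β′ * (Q * (- n′ + k′)) * ((1# + k′ - j′) * (s + n′ + (1# + k′) - 1#))
      ≈⟨ solve 8 (λ P α β Q s k j n →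
               P :* (s :- :1 :+ k) :* α :* β :* (Q :* (:- n :+ k)) :* ((:1 :+ k :- j) :* (s :+ n :+ (:1 :+ k) :- :1))
            := α :* (k :+ s :- :1) :* (β :* (:1 :+ k :- j)) :* P :* Q :* (:- n :+ k) :* (s :+ n :+ (:1 :+ k) :- :1))
            refl P α′ β′ Q s k′ j′ n′ ⟩
    α′ * γ * (β′ * (1# + k′ - j′)) * P * Q * (- n′ + k′) * (s + n′ + (1# + k′) - 1#)
      ≈⟨ *-congʳ (*-congʳ (*-congʳ (*-congʳ (*-cong α-step (poch-neg-suc k j))))) ⟩
    α * (γ + j′) * (β * (1# + k′)) * P * Q * (- n′ + k′) * (s + n′ + (1# + k′) - 1#)
      ≈⟨ solve 8 (λ P α β Q s k j n →
               α :* (k :+ s :- :1 :+ j) :* (β :* (:1 :+ k)) :* P :* Q :* (:- n :+ k) :* (s :+ n :+ (:1 :+ k) :- :1)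
            := P :* α :* β :* Q :* ((s :- :1 :+ k :+ j) :* (k :- n)) :* ((:1 :+ k) :* (s :+ n :+ k)))
            refl P α β Q s k′ j′ n′ ⟩
    sharedFactor j k * ((s - 1# + k′ + j′) * (k′ - n′)) * ((1# + k′) * (s + n′ + k′)) ∎
    where
    j′ = ofℕ j
    k′ = ofℕ k
    n′ = ofℕ n
    P  = poch (s - 1#) k
    Q  = poch (- n′) k
    γ  = k′ + s - 1#
    α  = poch γ j
    α′ = poch (ofℕ (suc k) + s - 1#) j
    β  = poch (- k′) j
    β′ = poch (- ofℕ (suc k)) j
    α-step : α′ * γ ≈ α * (γ + j′)
    α-step = trans (*-congʳ (poch-cong (solve 2 (λ k s → :1 :+ k :+ s :- :1 := k :+ s :- :1 :+ :1) refl k′ s) j))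
                   (poch-shift γ j)

  module _ (s≉1-m : ∀ m → s ≉ 1# - ofℕ m) where

    s-1+m≉0 : ∀ m → s - 1# + ofℕ m ≉ 0#
    s-1+m≉0 = ≉-ofℕ⇒+ofℕ≉0 λ m s-1≈-m → s≉1-m m (begin
      s               ≈⟨ solve 1 (λ s → s := s :- :1 :+ :1) refl s ⟩
      s - 1# + 1#     ≈⟨ +-congʳ s-1≈-m ⟩
      - ofℕ m + 1#    ≈⟨ +-comm _ _ ⟩
      1# - ofℕ m      ∎)

    s-1≉0 : s - 1# ≉ 0#
    s-1≉0 s-1≈0 = s-1+m≉0 0 (trans (+-identityʳ _) s-1≈0)

    s+n+m≉0 : ∀ m → s + ofℕ n + ofℕ m ≉ 0#
    s+n+m≉0 m s+n+m≈0 = s-1+m≉0 (suc (n ℕ.+ m)) (trans shifted s+n+m≈0)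
      where
      shifted : s - 1# + ofℕ (suc (n ℕ.+ m)) ≈ s + ofℕ n + ofℕ m
      shifted = begin
        s - 1# + ofℕ (suc (n ℕ.+ m))         ≈⟨ +-congˡ (+-congˡ (ofℕ-+ n m)) ⟩
        s - 1# + (1# + (ofℕ n + ofℕ m))      ≈⟨ solve 3 (λ s n m → s :- :1 :+ (:1 :+ (n :+ m)) := s :+ n :+ m) refl s (ofℕ n) (ofℕ m) ⟩
        s + ofℕ n + ofℕ m                    ∎

    h₀+m≉0 : ∀ m → h₀ + ofℕ m ≉ 0#
    h₀+m≉0 m h₀+m≈0 = s-1+m≉0 (m ℕ.+ m) (begin
      s - 1# + ofℕ (m ℕ.+ m)             ≈⟨ +-cong (sym h₀*2≈s-1) (ofℕ-+ m m) ⟩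
      h₀ * ofℕ 2 + (ofℕ m + ofℕ m)       ≈⟨ solve 2 (λ h m → h :* :2 :+ (m :+ m) := (h :+ m) :* :2) refl h₀ (ofℕ m) ⟩
      (h₀ + ofℕ m) * ofℕ 2               ≈⟨ x≈0⇒x*y≈0 h₀+m≈0 (ofℕ 2) ⟩
      0#                                 ∎)

    denominator≉0 : ∀ k → denominator k ≉ 0#
    denominator≉0 k = *-≉0 (*-≉0 (fact≉0 k) (poch≉0 h₀+m≉0 k)) (poch≉0 s+n+m≉0 k)

    certificateDenominator≉0 : ∀ k → certificateDenominator k ≉ 0#
    certificateDenominator≉0 k = *-≉0 (fact≉0 k) (poch≉0 s+n+m≉0 k)

    summand-cleared : ∀ j k → summand j k * certificateDenominator k * (s - 1#) ≈ sharedFactor j k * (s - 1# + (ofℕ k + ofℕ k))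
    summand-cleared j k = begin
      numerator k / denominator k * (β * α) * certificateDenominator k * (s - 1#)
        ≈⟨ solve 8 (λ P H Q Di β α C s → P :* H :* Q :* Di :* (β :* α) :* C :* (s :- :1) := P :* Q :* β :* α :* (H :* (s :- :1)) :* Di :* C)
                 refl P (poch h₁ k) Q (denominator k ⁻¹) β α (certificateDenominator k) s ⟩
      P * Q * β * α * (poch h₁ k * (s - 1#)) / denominator k * certificateDenominator k
        ≈⟨ *-congʳ (*-congʳ (*-congˡ (poch-h₁ k))) ⟩
      P * Q * β * α * (poch h₀ k * X) / denominator k * certificateDenominator k
        ≈⟨ *-congʳ (*-congʳ (solve 6 (λ P Q β α H X → P :* Q :* β :* α :* (H :* X) := P :* Q :* β :* α :* X :* H) refl P Q β α (poch h₀ k) X)) ⟩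
      P * Q * β * α * X * poch h₀ k / denominator k * certificateDenominator k
        ≈⟨ x*v/y*w≈x (denominator≉0 k) (solve 3 (λ f H S → f :* H :* S := f :* S :* H) refl (fact k) (poch h₀ k) (poch (s + ofℕ n) k)) ⟩
      P * Q * β * α * X
        ≈⟨ solve 5 (λ P Q β α X → P :* Q :* β :* α :* X := P :* α :* β :* Q :* X) refl P Q β α X ⟩
      sharedFactor j k * X ∎
      where
      P = poch (s - 1#) k
      Q = poch (- ofℕ n) k
      β = poch (- ofℕ k) j
      α = poch (ofℕ k + s - 1#) j
      X = s - 1# + (ofℕ k + ofℕ k)

    certificate-suc-cleared : ∀ j k → certificate j (suc k) * certificateDenominator k
                                      ≈ sharedFactor j k * ((s - 1# + ofℕ k + ofℕ j) * (ofℕ k - ofℕ n))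
    certificate-suc-cleared j k = trans (*-congʳ (*-congʳ (sharedFactor-suc j k)))
      (x*v/y*w≈x (certificateDenominator≉0 (suc k)) (certificateDenominator-suc k))

    certificate-difference : ∀ j k → (ofℕ j - ofℕ n) * (s - 1#) * summand j k ≈ certificate j (suc k) - certificate j k
    certificate-difference j k = *-cancelʳ (certificateDenominator≉0 k) (begin
      (j′ - n′) * (s - 1#) * summand j k * C
        ≈⟨ solve 5 (λ j n s t c → (j :- n) :* (s :- :1) :* t :* c := (j :- n) :* (t :* c :* (s :- :1))) refl j′ n′ s (summand j k) C ⟩
      (j′ - n′) * (summand j k * C * (s - 1#))
        ≈⟨ *-congˡ (summand-cleared j k) ⟩
      (j′ - n′) * (F * (s - 1# + (k′ + k′)))
        ≈⟨ solve 5 (λ j n s k F → (j :- n) :* (F :* (s :- :1 :+ (k :+ k)))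
                               := F :* ((s :- :1 :+ k :+ j) :* (k :- n)) :- F :* ((k :- j) :* (s :+ n :+ k :- :1)))
                 refl j′ n′ s k′ F ⟩
      F * ((s - 1# + k′ + j′) * (k′ - n′)) - F * ((k′ - j′) * (s + n′ + k′ - 1#))
        ≈⟨ +-cong (sym (certificate-suc-cleared j k)) (-‿cong (sym (/-*-cancelʳ (certificateDenominator≉0 k) _))) ⟩
      certificate j (suc k) * C - certificate j k * C
        ≈⟨ solve 3 (λ a b c → a :* c :- b :* c := (a :- b) :* c) refl (certificate j (suc k)) (certificate j k) C ⟩
      (certificate j (suc k) - certificate j k) * C ∎)
      where
      j′ = ofℕ j
      k′ = ofℕ k
      n′ = ofℕ n
      C  = certificateDenominator k
      F  = sharedFactor j k

    sumTo-summand-vanish : ∀ {j} → j ℕ.< n → sumTo n (summand j) ≈ 0#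
    sumTo-summand-vanish {j} j<n = *-cancelʳ (*-≉0 (<⇒ofℕ-ofℕ≉0 j<n) s-1≉0) (begin
      sumTo n (summand j) * μ                                   ≈⟨ *-comm _ _ ⟩
      μ * sumTo n (summand j)                                   ≈⟨ sumTo-*ˡ n (summand j) μ ⟩
      sumTo n (λ k → μ * summand j k)                           ≈⟨ sumTo-cong n (λ k _ → certificate-difference j k) ⟩
      sumTo n (λ k → certificate j (suc k) - certificate j k)   ≈⟨ sumTo-telescope n (certificate j) ⟩
      certificate j (suc n) - certificate j 0                   ≈⟨ +-cong (certificate-end j) (-‿cong (certificate-start j)) ⟩
      0# - 0#                                                   ≈⟨ -‿inverseʳ 0# ⟩
      0#                                                        ≈⟨ zeroˡ μ ⟨
      0# * μ                                                    ∎)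
      where μ = (ofℕ j - ofℕ n) * (s - 1#)

    -- (s - 1)ₙ (n + s - 1)ₙ (h₁)ₙ / (h₀)ₙ = (s - 1)₂ₙ (s - 1 + 2n) / (s - 1) = (s)₂ₙ = (s)ₙ (s + n)ₙ,
    -- and (-n)ₙ² = n!².
    summand-diagonal : summand n n ≈ fact n * poch s n
    summand-diagonal = begin
      numerator n / denominator n * (B * α)      ≈⟨ solve 4 (λ a d b c → a :* d :* (b :* c) := a :* (b :* c) :* d) refl (numerator n) (denominator n ⁻¹) B α ⟩
      numerator n * (B * α) / denominator n      ≈⟨ x≈z*y⇒x/y≈z (denominator≉0 n) (*-cancelʳ s-1≉0 cleared) ⟩
      fact n * poch s n                          ∎
      where
      n′ = ofℕ n
      P  = poch (s - 1#) n
      B  = poch (- n′) n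
      α  = poch (n′ + s - 1#) n
      H  = poch h₀ n
      S  = poch (s + n′) n
      f  = fact n
      X  = s - 1# + ofℕ (n ℕ.+ n)
      doubling : poch (s - 1#) (n ℕ.+ n) ≈ P * α
      doubling = trans (poch-+ (s - 1#) n n) (*-congˡ (poch-cong (solve 2 (λ s n → s :- :1 :+ n := n :+ s :- :1) refl s n′) n))
      unshift : poch (s - 1#) (n ℕ.+ n) * X ≈ poch s (n ℕ.+ n) * (s - 1#)
      unshift = trans (sym (poch-shift (s - 1#) (n ℕ.+ n))) (*-congʳ (poch-cong (solve 1 (λ s → s :- :1 :+ :1 := s) refl s) (n ℕ.+ n)))
      cleared : numerator n * (B * α) * (s - 1#) ≈ f * poch s n * denominator n * (s - 1#)
      cleared = begin
        P * poch h₁ n * B * (B * α) * (s - 1#)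
          ≈⟨ solve 5 (λ P H B α s → P :* H :* B :* (B :* α) :* s := P :* α :* (H :* s) :* (B :* B)) refl P (poch h₁ n) B α (s - 1#) ⟩
        P * α * (poch h₁ n * (s - 1#)) * (B * B)          ≈⟨ *-cong (*-cong (sym doubling) (poch-h₁ n)) (poch-neg-square n) ⟩
        poch (s - 1#) (n ℕ.+ n) * (H * (s - 1# + (n′ + n′))) * (f * f)
                                                          ≈⟨ *-congʳ (*-congˡ (*-congˡ (+-congˡ (sym (ofℕ-+ n n))))) ⟩
        poch (s - 1#) (n ℕ.+ n) * (H * X) * (f * f)
          ≈⟨ solve 4 (λ P H X F → P :* (H :* X) :* F := P :* X :* H :* F) refl (poch (s - 1#) (n ℕ.+ n)) H X (f * f) ⟩
        poch (s - 1#) (n ℕ.+ n) * X * H * (f * f)         ≈⟨ *-congʳ (*-congʳ unshift) ⟩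
        poch s (n ℕ.+ n) * (s - 1#) * H * (f * f)         ≈⟨ *-congʳ (*-congʳ (*-congʳ (poch-+ s n n))) ⟩
        poch s n * S * (s - 1#) * H * (f * f)
          ≈⟨ solve 5 (λ p S s H f → p :* S :* s :* H :* (f :* f) := f :* p :* (f :* H :* S) :* s) refl (poch s n) S (s - 1#) H f ⟩
        f * poch s n * denominator n * (s - 1#)           ∎

    connection : ∀ (w : ℕ → Carrier) → sumTo n (λ k → sumTo k (λ j → summand j k * w j)) ≈ fact n * poch s n * w n
    connection w = begin
      sumTo n (λ k → sumTo k (λ j → summand j k * w j))   ≈⟨ sumTo-cong n (λ k k≤n → sumTo-extend n _ k≤n (λ j k<j → upper k<j)) ⟩
      sumTo n (λ k → sumTo n (λ j → summand j k * w j))   ≈⟨ sumTo-comm n n _ ⟩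
      sumTo n (λ j → sumTo n (λ k → summand j k * w j))   ≈⟨ sumTo-cong n (λ j _ → sym (sumTo-*ʳ n (summand j) (w j))) ⟩
      sumTo n (λ j → sumTo n (summand j) * w j)           ≈⟨ sumTo-last n _ (λ j j<n → x≈0⇒x*y≈0 (sumTo-summand-vanish j<n) (w j)) ⟩
      sumTo n (summand n) * w n                           ≈⟨ *-congʳ (sumTo-last n (summand n) (λ k k<n → summand-vanish k<n)) ⟩
      summand n n * w n                                   ≈⟨ *-congʳ summand-diagonal ⟩
      fact n * poch s n * w n                             ∎
      where
      upper : ∀ {j k} → k ℕ.< j → summand j k * w j ≈ 0#
      upper k<j = x≈0⇒x*y≈0 (summand-vanish k<j) _

module WilsonExpansion {ℓ₁ ℓ₂ : Level} (K : ACF₀ ℓ₁ ℓ₂) (i a b c d x : ACF₀.Carrier K) (n : ℕ) where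
  open ACF₀ K
  open FieldOps K
  open IntegerCoefficients commRing
  open FieldLemmas K
  open SumLemmas K
  open PochhammerLemmas K
  open ConnectionCoefficients K (a + b + c + d) n
  open SetoidReasoning setoid

  p q r u v : Carrier
  p = a + b
  q = a + c
  r = a + d
  u = a + i * x
  v = a - i * x

  term weight : ℕ → Carrier
  term k   = numerator k / (denominator k * poch p k * poch q k * poch r k) * wilson i a b c d x k
  weight j = (poch u j * poch v j) / (fact j * poch p j * poch q j * poch r j)

  module _ (p≉-m : ∀ m → p ≉ - ofℕ m) (q≉-m : ∀ m → q ≉ - ofℕ m) (r≉-m : ∀ m → r ≉ - ofℕ m) where

    pqr≉0 : ∀ k → poch p k * poch q k * poch r k ≉ 0#
    pqr≉0 k = *-≉0 (*-≉0 (≉-ofℕ⇒poch≉0 p≉-m k) (≉-ofℕ⇒poch≉0 q≉-m k)) (≉-ofℕ⇒poch≉0 r≉-m k)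

    *pqr≉0 : ∀ {y} → y ≉ 0# → ∀ k → y * poch p k * poch q k * poch r k ≉ 0#
    *pqr≉0 y≉0 k = *-≉0 (*-≉0 (*-≉0 y≉0 (≉-ofℕ⇒poch≉0 p≉-m k)) (≉-ofℕ⇒poch≉0 q≉-m k)) (≉-ofℕ⇒poch≉0 r≉-m k)

    term-expand : (∀ m → a + b + c + d ≉ 1# - ofℕ m) → ∀ k → term k ≈ sumTo k (λ j → summand j k * weight j)
    term-expand s≉1-m k = begin
      numerator k / D * (P * sumTo k inner)
        ≈⟨ solve 4 (λ N Di P S → N :* Di :* (P :* S) := N :* P :* Di :* S) refl (numerator k) (D ⁻¹) P (sumTo k inner) ⟩
      numerator k * P / D * sumTo k inner         ≈⟨ *-congʳ (x*w≈z*y⇒x/y≈z/w (*pqr≉0 (denominator≉0 s≉1-m k) k) (denominator≉0 s≉1-m k) cross) ⟩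
      coeff k * sumTo k inner                     ≈⟨ sumTo-*ˡ k inner (coeff k) ⟩
      sumTo k (λ j → coeff k * inner j)           ≈⟨ sumTo-cong k (λ j _ → regroup j) ⟩
      sumTo k (λ j → summand j k * weight j)      ∎
      where
      P = poch p k * poch q k * poch r k
      D = denominator k * poch p k * poch q k * poch r k
      E : ℕ → Carrier
      E j = fact j * poch p j * poch q j * poch r j
      inner : ℕ → Carrier
      inner j = (poch (- ofℕ k) j * poch (ofℕ k + (a + b + c + d) - 1#) j * poch u j * poch v j) / E j
      cross : numerator k * P * denominator k ≈ numerator k * D
      cross = solve 5 (λ N D x y z → N :* (x :* y :* z) :* D := N :* (D :* x :* y :* z)) refl (numerator k) (denominator k) (poch p k) (poch q k) (poch r k)
      regroup : ∀ j → coeff k * inner j ≈ summand j k * weight j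
      regroup j = solve 6 (λ c β α U V Ei → c :* (β :* α :* U :* V :* Ei) := c :* (β :* α) :* (U :* V :* Ei))
                    refl (coeff k) (poch (- ofℕ k) j) (poch (ofℕ k + (a + b + c + d) - 1#) j) (poch u j) (poch v j) (E j ⁻¹)

    diagonal-contribution : fact n * poch (a + b + c + d) n * weight n
                            ≈ (poch (a + b + c + d) n * poch u n * poch v n) / (poch p n * poch q n * poch r n)
    diagonal-contribution = begin
      f * S * (poch u n * poch v n * E ⁻¹)
        ≈⟨ solve 5 (λ f S U V Ei → f :* S :* (U :* V :* Ei) := f :* S :* U :* V :* Ei) refl f S (poch u n) (poch v n) (E ⁻¹) ⟩
      f * S * poch u n * poch v n / E           ≈⟨ x*w≈z*y⇒x/y≈z/w (*pqr≉0 (fact≉0 n) n) (pqr≉0 n) cross ⟩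
      S * poch u n * poch v n / (poch p n * poch q n * poch r n) ∎
      where
      f = fact n
      S = poch (a + b + c + d) n
      E = f * poch p n * poch q n * poch r n
      cross : f * S * poch u n * poch v n * (poch p n * poch q n * poch r n) ≈ S * poch u n * poch v n * E
      cross = solve 7 (λ f S U V x y z → f :* S :* U :* V :* (x :* y :* z) := S :* U :* V :* (f :* x :* y :* z)) refl f S (poch u n) (poch v n) (poch p n) (poch q n) (poch r n)

mainTheorem9 : {c ℓ : Level} (K : ACF₀ c ℓ) →
    let open ACF₀ K in let open FieldOps K in
    (i : Carrier) → i * i ≈ - 1# →
    (a b c d : Carrier) →
    (∀ m → ¬ (a + b + c + d ≈ 1# - ofℕ m)) →
    (∀ m → ¬ (a + b ≈ - ofℕ m)) →
    (∀ m → ¬ (a + c ≈ - ofℕ m)) →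
    (∀ m → ¬ (a + d ≈ - ofℕ m)) →
    (x : Carrier) → (n : ℕ) →
    let s = a + b + c + d in
    sumTo n (λ k →
        (poch (s - 1#) k * poch ((s + 1#) / ofℕ 2) k * poch (- ofℕ n) k)
        / (fact k * poch ((s - 1#) / ofℕ 2) k * poch (s + ofℕ n) k
            * poch (a + b) k * poch (a + c) k * poch (a + d) k)
        * wilson i a b c d x k)
      ≈ (poch s n * poch (a + i * x) n * poch (a - i * x) n)
        / (poch (a + b) n * poch (a + c) n * poch (a + d) n)
mainTheorem9 K i _ a b c d s≉1-m p≉-m q≉-m r≉-m x n = begin
  sumTo n term                                                ≈⟨ sumTo-cong n (λ k _ → term-expand p≉-m q≉-m r≉-m s≉1-m k) ⟩
  sumTo n (λ k → sumTo k (λ j → summand j k * weight j))      ≈⟨ connection s≉1-m weight ⟩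
  fact n * poch (a + b + c + d) n * weight n                  ≈⟨ diagonal-contribution p≉-m q≉-m r≉-m ⟩
  (poch (a + b + c + d) n * poch u n * poch v n) / (poch p n * poch q n * poch r n) ∎
  where
  open ACF₀ K
  open FieldOps K
  open SumLemmas K using (sumTo-cong)
  open ConnectionCoefficients K (a + b + c + d) n using (summand; connection)
  open WilsonExpansion K i a b c d x n
  open SetoidReasoning setoid
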